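{- Let $\Sigma$ be an implicational base over a finite set $U$ with closure system $\mathcal{C}$, and let $(U_1,U_2)$ be an acyclic split of $\Sigma$. Let $C_2\in\mathcal{C}_2$ and $C_1\subseteq U_1$. Then $C_1\cup C_2$ is an extension of $C_2$ (i.e. $C_1\cup C_2\in\mathcal{C}$) if and only if $C_1\in\mathcal{C}_1$ and, for every implication $A\to b\in\Sigma[U_1,U_2]$, $A\subseteq C_1$ implies $b\in C_2$.
   Context: An implication over $U$ is written $A \to b$ with $A \subseteq U$ nonempty and $b \in U$; an implicational base is a finite set of implications. $C\subseteq U$ satisfies $\Sigma$ if for all $A\to b\in\Sigma$, $A\subseteq C$ implies $b\in C$; the closure system of $\Sigma$ is the family of subsets satisfying $\Sigma$. For $X\subseteq U$, $\Sigma[X]=\{A\to b\in\Sigma: A\cup\{b\}\subseteq X\}$. A split of $\Sigma$ is a bipartition $(U_1,U_2)$ of $U$ into nonempty disjoint sets such that every premise is contained in $U_1$ or in $U_2$; $\Sigma[U_1,U_2]:=\Sigma\setminus(\Sigma[U_1]\cup\Sigma[U_2])$. The split is acyclic if $A\subseteq U_1$ for every $A\to b\in\Sigma[U_1,U_2]$. $\mathcal{C}_1$, $\mathcal{C}_2$ denote the closure systems of $\Sigma[U_1]$ (over $U_1$) and $\Sigma[U_2]$ (over $U_2$). For $C_2\in\mathcal{C}_2$, an extension of $C_2$ is a set $C\in\mathcal{C}$ with $C\cap U_2=C_2$. -}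

module Defs where

open import Data.Nat using (ℕ)
open import Data.Fin using (Fin)
open import Data.Fin.Subset using (Subset; _∈_; _∉_; _⊆_; _∪_; ∁; Nonempty)
open import Data.List using (List)
open import Data.List.Membership.Propositional renaming (_∈_ to _∈ₗ_)
open import Data.Product using (_×_; Σ)
open import Data.Sum using (_⊎_)
open import Relation.Nullary using (¬_)

record Implication (n : ℕ) : Set where
  constructor _⇒_∣_
  field
    premise    : Subset n
    conclusion : Fin n
    nonempty   : Nonempty premise
open Implication public

ImplicationalBase : ℕ → Set
ImplicationalBase n = List (Implication n)

SatisfiesImp : ∀ {n} → Subset n → Implication n → Set
SatisfiesImp C i = premise i ⊆ C → conclusion i ∈ C

-- C satisfies Σ (i.e. C belongs to the closure system of Σ over U)
Satisfies : ∀ {n} → Subset n → ImplicationalBase n → Set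
Satisfies C Σ' = ∀ i → i ∈ₗ Σ' → SatisfiesImp C i

-- The implication A → b lies in Σ[X], i.e. A ∪ {b} ⊆ X.
InRestriction : ∀ {n} → Subset n → Implication n → Set
InRestriction X i = premise i ⊆ X × conclusion i ∈ X

-- C ⊆ X lies in the closure system of Σ[X] over X.
InClosureSystemOn : ∀ {n} → ImplicationalBase n → Subset n → Subset n → Set
InClosureSystemOn Σ' X C =
  C ⊆ X × (∀ i → i ∈ₗ Σ' → InRestriction X i → SatisfiesImp C i)

-- (U₁ , ∁ U₁) is a split of Σ: both parts nonempty, every premise is
-- contained in U₁ or in U₂ = ∁ U₁.
IsSplit : ∀ {n} → ImplicationalBase n → Subset n → Set
IsSplit Σ' U₁ =
  Nonempty U₁ × Nonempty (∁ U₁) ×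
  (∀ i → i ∈ₗ Σ' → premise i ⊆ U₁ ⊎ premise i ⊆ ∁ U₁)

-- i ∈ Σ[U₁,U₂] = Σ \ (Σ[U₁] ∪ Σ[U₂])
InCross : ∀ {n} → ImplicationalBase n → Subset n → Implication n → Set
InCross Σ' U₁ i =
  i ∈ₗ Σ' × ¬ InRestriction U₁ i × ¬ InRestriction (∁ U₁) i

IsAcyclicSplit : ∀ {n} → ImplicationalBase n → Subset n → Set
IsAcyclicSplit Σ' U₁ =
  IsSplit Σ' U₁ × (∀ i → InCross Σ' U₁ i → premise i ⊆ U₁)

-- Inside U₁ the set C₁ ∪ C₂ is just C₁ and inside U₂ it is C₂, so each
-- implication of Σ[U₁] or Σ[U₂] holds for C₁ ∪ C₂ exactly when it holds
-- for C₁ resp. C₂.  A crossing implication has, by acyclicity, its premise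
-- in U₁, hence inside C₁ ∪ C₂ exactly when inside C₁; its conclusion then
-- lies outside U₁, so it belongs to C₁ ∪ C₂ exactly when it belongs to C₂.
module Submission where

open import Defs
open import Data.Nat using (ℕ)
open import Data.Fin using (Fin)
open import Data.Fin.Subset using (Subset; _∈_; _⊆_; _∪_; ∁)
open import Data.Fin.Subset.Properties
  using (_∈?_; _⊆?_; ⊆-trans; p⊆p∪q; q⊆p∪q; x∈p∪q⁻; x∈∁p⇒x∉p; x∉p⇒x∈∁p)
open import Data.List.Membership.Propositional renaming (_∈_ to _∈ₗ_)
open import Data.Product using (_×_; _,_)
open import Data.Sum using (_⊎_; inj₁; inj₂)
open import Data.Empty using (⊥-elim)
open import Relation.Nullary using (Dec; yes; no; _×-dec_)
open import Function.Bundles using (_⇔_; mk⇔)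

module _ {n : ℕ} {X C₁ C₂ : Subset n} where

  ∈∪⇒∈ˡ : ∀ {x : Fin n} → C₂ ⊆ ∁ X → x ∈ C₁ ∪ C₂ → x ∈ X → x ∈ C₁
  ∈∪⇒∈ˡ {x} C₂⊆∁X x∈C₁∪C₂ x∈X with x∈p∪q⁻ C₁ C₂ x∈C₁∪C₂
  ... | inj₁ x∈C₁ = x∈C₁
  ... | inj₂ x∈C₂ = ⊥-elim (x∈∁p⇒x∉p (C₂⊆∁X x∈C₂) x∈X)

  ∈∪⇒∈ʳ : ∀ {x : Fin n} → C₁ ⊆ X → x ∈ C₁ ∪ C₂ → x ∈ ∁ X → x ∈ C₂
  ∈∪⇒∈ʳ {x} C₁⊆X x∈C₁∪C₂ x∈∁X with x∈p∪q⁻ C₁ C₂ x∈C₁∪C₂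
  ... | inj₁ x∈C₁ = ⊥-elim (x∈∁p⇒x∉p x∈∁X (C₁⊆X x∈C₁))
  ... | inj₂ x∈C₂ = x∈C₂

  ⊆∪⇒⊆ˡ : ∀ {A : Subset n} → C₂ ⊆ ∁ X → A ⊆ C₁ ∪ C₂ → A ⊆ X → A ⊆ C₁
  ⊆∪⇒⊆ˡ C₂⊆∁X A⊆C₁∪C₂ A⊆X x∈A = ∈∪⇒∈ˡ C₂⊆∁X (A⊆C₁∪C₂ x∈A) (A⊆X x∈A)

  ⊆∪⇒⊆ʳ : ∀ {A : Subset n} → C₁ ⊆ X → A ⊆ C₁ ∪ C₂ → A ⊆ ∁ X → A ⊆ C₂
  ⊆∪⇒⊆ʳ C₁⊆X A⊆C₁∪C₂ A⊆∁X x∈A = ∈∪⇒∈ʳ C₁⊆X (A⊆C₁∪C₂ x∈A) (A⊆∁X x∈A)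

inRestriction? : ∀ {n} (X : Subset n) (i : Implication n) → Dec (InRestriction X i)
inRestriction? X i = (premise i ⊆? X) ×-dec (conclusion i ∈? X)

restriction-or-cross : ∀ {n} {Σ' : ImplicationalBase n} (X : Subset n) {i : Implication n} →
  i ∈ₗ Σ' → InRestriction X i ⊎ InRestriction (∁ X) i ⊎ InCross Σ' X i
restriction-or-cross X {i} i∈Σ with inRestriction? X i | inRestriction? (∁ X) i
... | yes inX | _        = inj₁ inX
... | no _    | yes in∁X = inj₂ (inj₁ in∁X)
... | no ¬inX | no ¬in∁X = inj₂ (inj₂ (i∈Σ , ¬inX , ¬in∁X))

proposition5 : (n : ℕ) (Σ' : ImplicationalBase n) (U₁ : Subset n) →
    IsAcyclicSplit Σ' U₁ →
    (C₂ : Subset n) → InClosureSystemOn Σ' (∁ U₁) C₂ →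
    (C₁ : Subset n) → C₁ ⊆ U₁ →
    (Satisfies (C₁ ∪ C₂) Σ' ⇔
      (InClosureSystemOn Σ' U₁ C₁ ×
        (∀ i → InCross Σ' U₁ i → premise i ⊆ C₁ → conclusion i ∈ C₂)))
proposition5 n Σ' U₁ (_ , acyclic) C₂ (C₂⊆∁U₁ , C₂-closed) C₁ C₁⊆U₁ = mk⇔ restrict extend
  where
  restrict : Satisfies (C₁ ∪ C₂) Σ' →
    InClosureSystemOn Σ' U₁ C₁ × (∀ i → InCross Σ' U₁ i → premise i ⊆ C₁ → conclusion i ∈ C₂)
  restrict sat = (C₁⊆U₁ , C₁-closed) , cross-into-C₂
    where
    C₁-closed : ∀ i → i ∈ₗ Σ' → InRestriction U₁ i → SatisfiesImp C₁ i
    C₁-closed i i∈Σ (_ , b∈U₁) A⊆C₁ =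
      ∈∪⇒∈ˡ C₂⊆∁U₁ (sat i i∈Σ (⊆-trans A⊆C₁ (p⊆p∪q C₂))) b∈U₁
    cross-into-C₂ : ∀ i → InCross Σ' U₁ i → premise i ⊆ C₁ → conclusion i ∈ C₂
    cross-into-C₂ i (i∈Σ , ¬inU₁ , _) A⊆C₁ =
      ∈∪⇒∈ʳ C₁⊆U₁ (sat i i∈Σ (⊆-trans A⊆C₁ (p⊆p∪q C₂)))
        (x∉p⇒x∈∁p (λ b∈U₁ → ¬inU₁ (⊆-trans A⊆C₁ C₁⊆U₁ , b∈U₁)))

  extend : InClosureSystemOn Σ' U₁ C₁ × (∀ i → InCross Σ' U₁ i → premise i ⊆ C₁ → conclusion i ∈ C₂) →
    Satisfies (C₁ ∪ C₂) Σ'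
  extend ((_ , C₁-closed) , cross-into-C₂) i i∈Σ A⊆C₁∪C₂ with restriction-or-cross U₁ i∈Σ
  ... | inj₁ inU₁@(A⊆U₁ , _) =
    p⊆p∪q C₂ (C₁-closed i i∈Σ inU₁ (⊆∪⇒⊆ˡ C₂⊆∁U₁ A⊆C₁∪C₂ A⊆U₁))
  ... | inj₂ (inj₁ in∁U₁@(A⊆∁U₁ , _)) =
    q⊆p∪q C₁ C₂ (C₂-closed i i∈Σ in∁U₁ (⊆∪⇒⊆ʳ C₁⊆U₁ A⊆C₁∪C₂ A⊆∁U₁))
  ... | inj₂ (inj₂ cross) =
    q⊆p∪q C₁ C₂ (cross-into-C₂ i cross (⊆∪⇒⊆ˡ C₂⊆∁U₁ A⊆C₁∪C₂ (acyclic i cross)))
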